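{- Let $(A,d)$ be a diffuse metric space. Then $(\mathcal{D}(A),\mathrm{LK}_d)$ is a diffuse metric space, where for $\mu,\nu\in\mathcal{D}(A)$, $\mathrm{LK}_d(\mu,\nu)=\sum_{x\in\mathrm{supp}(\mu)}\sum_{y\in\mathrm{supp}(\nu)}\mu(x)\,\nu(y)\,d(x,y)$.
   Context: A diffuse metric space is a set $A$ with $d:A\times A\to[0,1]$ satisfying $d(a,b)=d(b,a)$ and $d(a,c)\le d(a,b)+d(b,c)$ for all $a,b,c\in A$ (no reflexivity is required). $\mathcal{D}(A)$ is the set of finitely supported probability distributions on $A$, i.e. functions $\mu:A\to[0,1]$ with finite support $\mathrm{supp}(\mu)=\{a\mid\mu(a)>0\}$ and $\sum_a\mu(a)=1$. -}

module Defs where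

open import Level using (0ℓ)
open import Data.Product using (Σ; _×_; _,_)
open import Data.List using (List; []; _∷_; map; foldr)
open import Data.List.Membership.Propositional using (_∈_)
open import Data.List.Relation.Unary.Unique.Propositional using (Unique)
open import Relation.Binary.PropositionalEquality using (_≡_)
open import Relation.Nullary using (¬_)
open import Relation.Binary.Structures using (IsTotalOrder)
open import Algebra.Structures using (IsCommutativeRing)
open import Function.Bundles using (_⇔_)

record RealField : Set₁ where
  infixl 6 _+_
  infixl 7 _*_
  infix 4 _≤_ _<_
  field
    ℝ    : Set
    _+_  : ℝ → ℝ → ℝ
    _*_  : ℝ → ℝ → ℝ
    -_   : ℝ → ℝ
    0ℝ   : ℝ
    1ℝ   : ℝ
    _≤_  : ℝ → ℝ → Set
    isCommutativeRing : IsCommutativeRing _≡_ _+_ _*_ -_ 0ℝ 1ℝ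
    0≢1  : ¬ (0ℝ ≡ 1ℝ)
    inverse : ∀ x → ¬ (x ≡ 0ℝ) → Σ ℝ (λ y → x * y ≡ 1ℝ)
    isTotalOrder : IsTotalOrder _≡_ _≤_
    +-mono-≤ : ∀ {x y} z → x ≤ y → x + z ≤ y + z
    *-nonneg : ∀ {x y} → 0ℝ ≤ x → 0ℝ ≤ y → 0ℝ ≤ x * y
    complete : (P : ℝ → Set) → Σ ℝ P → Σ ℝ (λ b → ∀ x → P x → x ≤ b) →
               Σ ℝ (λ s → (∀ x → P x → x ≤ s) × (∀ b → (∀ x → P x → x ≤ b) → s ≤ b))

  _<_ : ℝ → ℝ → Set
  x < y = (x ≤ y) × ¬ (x ≡ y)

  sumL : List ℝ → ℝ
  sumL = foldr _+_ 0ℝ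

module _ (R : RealField) where
  open RealField R

  record IsDiffuseMetric (A : Set) (d : A → A → ℝ) : Set where
    field
      d-nonneg : ∀ a b → 0ℝ ≤ d a b
      d-le-1   : ∀ a b → d a b ≤ 1ℝ
      d-sym    : ∀ a b → d a b ≡ d b a
      d-tri    : ∀ a b c → d a c ≤ d a b + d b c

  record Dist (A : Set) : Set where
    field
      μ        : A → ℝ
      μ-nonneg : ∀ a → 0ℝ ≤ μ a
      μ-le-1   : ∀ a → μ a ≤ 1ℝ
      supp     : List A
      supp-unique : Unique supp
      supp-spec   : ∀ a → (a ∈ supp) ⇔ (0ℝ < μ a)
      sum-one  : sumL (map μ supp) ≡ 1ℝ

  open Dist

  LK : {A : Set} → (A → A → ℝ) → Dist A → Dist A → ℝ
  LK d m n = sumL (map (λ x → sumL (map (λ y → μ m x * μ n y * d x y) (supp n))) (supp m))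

-- LK_d(μ, ν) is the expectation of d under the product distribution μ ⊗ ν, so
-- bounds and symmetry of d transfer directly. For the triangle inequality all
-- three distances are read as expectations under the triple product μ ⊗ ν ⊗ ρ:
-- integrating out a coordinate that d does not see costs nothing because each
-- distribution has total mass 1, and then d(x,z) ≤ d(x,y) + d(y,z) holds pointwise.
module Submission where

open import Data.List using (List; []; _∷_; map; foldr)
open import Algebra.Bundles using (CommutativeSemiring; CommutativeRing)
open import Algebra.Structures using (IsCommutativeRing)
import Algebra.Properties.CommutativeSemigroup as CommutativeSemigroupProperties
open import Relation.Binary.Bundles using (Poset)
open import Relation.Binary.Structures using (IsTotalOrder)
open import Relation.Binary.PropositionalEquality as ≡ using (_≡_)
import Relation.Binary.Reasoning.PartialOrder as PartialOrderReasoning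
import Relation.Binary.Reasoning.Setoid as SetoidReasoning
open import Defs

module ListSum {c ℓ} (S : CommutativeSemiring c ℓ) where
  open CommutativeSemiring S
  open CommutativeSemigroupProperties +-commutativeSemigroup using (interchange)
  open SetoidReasoning setoid

  private variable X Y : Set

  ∑ : List X → (X → Carrier) → Carrier
  ∑ xs f = foldr _+_ 0# (map f xs)

  syntax ∑ xs (λ x → e) = ∑[ x ∈ xs ] e

  ∑-cong : (xs : List X) {f g : X → Carrier} → (∀ x → f x ≈ g x) → ∑ xs f ≈ ∑ xs g
  ∑-cong []       f≈g = refl
  ∑-cong (x ∷ xs) f≈g = +-cong (f≈g x) (∑-cong xs f≈g)

  ∑-zero : (xs : List X) → ∑[ _ ∈ xs ] 0# ≈ 0#
  ∑-zero []       = refl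
  ∑-zero (x ∷ xs) = trans (+-congˡ (∑-zero xs)) (+-identityˡ 0#)

  ∑-+ : (xs : List X) (f g : X → Carrier) → ∑[ x ∈ xs ] (f x + g x) ≈ ∑ xs f + ∑ xs g
  ∑-+ []       f g = sym (+-identityˡ 0#)
  ∑-+ (x ∷ xs) f g = trans (+-congˡ (∑-+ xs f g)) (interchange (f x) (g x) _ _)

  ∑-*ˡ : (xs : List X) (a : Carrier) (f : X → Carrier) → ∑[ x ∈ xs ] (a * f x) ≈ a * ∑ xs f
  ∑-*ˡ []       a f = sym (zeroʳ a)
  ∑-*ˡ (x ∷ xs) a f = trans (+-congˡ (∑-*ˡ xs a f)) (sym (distribˡ a (f x) _))

  ∑-comm : (xs : List X) (ys : List Y) (f : X → Y → Carrier) →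
           ∑[ x ∈ xs ] ∑[ y ∈ ys ] f x y ≈ ∑[ y ∈ ys ] ∑[ x ∈ xs ] f x y
  ∑-comm []       ys f = sym (∑-zero ys)
  ∑-comm (x ∷ xs) ys f = trans (+-congˡ (∑-comm xs ys f)) (sym (∑-+ ys (f x) _))

  ∑-weighted-const : (xs : List X) {w : X → Carrier} → ∑ xs w ≈ 1# →
                     ∀ t → ∑[ x ∈ xs ] (w x * t) ≈ t
  ∑-weighted-const xs {w} mass t = begin
    ∑[ x ∈ xs ] (w x * t) ≈⟨ ∑-cong xs (λ x → *-comm (w x) t) ⟩
    ∑[ x ∈ xs ] (t * w x) ≈⟨ ∑-*ˡ xs t w ⟩
    t * ∑ xs w            ≈⟨ *-congˡ mass ⟩
    t * 1#                ≈⟨ *-identityʳ t ⟩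
    t                     ∎

module Kantorovich (R : RealField) where
  open RealField R
  open IsCommutativeRing isCommutativeRing
    using ( +-comm; +-assoc; *-comm; *-assoc; +-identityˡ; +-identityʳ
          ; -‿inverseˡ; -‿inverseʳ; distribˡ)
  open IsTotalOrder isTotalOrder
    using (isPartialOrder) renaming (refl to ≤-refl; trans to ≤-trans)
  open Dist

  ℝ-commutativeRing : CommutativeRing _ _
  ℝ-commutativeRing = record { isCommutativeRing = isCommutativeRing }

  open ListSum (CommutativeRing.commutativeSemiring ℝ-commutativeRing)

  open CommutativeSemigroupProperties (CommutativeRing.*-commutativeSemigroup ℝ-commutativeRing)
    using (xy∙z≈y∙xz; x∙yz≈yx∙z; xy∙z≈xz∙y)

  ≤-poset : Poset _ _ _
  ≤-poset = record { isPartialOrder = isPartialOrder }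

  open PartialOrderReasoning ≤-poset

  +-monoʳ-≤ : ∀ z {x y} → x ≤ y → z + x ≤ z + y
  +-monoʳ-≤ z {x} {y} x≤y = begin
    z + x ≡⟨ +-comm z x ⟩
    x + z ≤⟨ +-mono-≤ z x≤y ⟩
    y + z ≡⟨ +-comm y z ⟩
    z + y ∎

  +-mono₂-≤ : ∀ {u v x y} → u ≤ v → x ≤ y → u + x ≤ v + y
  +-mono₂-≤ {v = v} {x} u≤v x≤y = ≤-trans (+-mono-≤ x u≤v) (+-monoʳ-≤ v x≤y)

  *-monoˡ-≤-nonNeg : ∀ {k x y} → 0ℝ ≤ k → x ≤ y → k * x ≤ k * y
  *-monoˡ-≤-nonNeg {k} {x} {y} 0≤k x≤y = begin
    k * x                 ≡⟨ ≡.sym (+-identityˡ (k * x)) ⟩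
    0ℝ + k * x            ≤⟨ +-mono-≤ (k * x) (*-nonneg 0≤k 0≤y-x) ⟩
    k * (y + - x) + k * x ≡⟨ ≡.sym (distribˡ k (y + - x) x) ⟩
    k * (y + - x + x)     ≡⟨ ≡.cong (k *_) y-x+x≡y ⟩
    k * y                 ∎
    where
    0≤y-x : 0ℝ ≤ y + - x
    0≤y-x = begin
      0ℝ      ≡⟨ ≡.sym (-‿inverseʳ x) ⟩
      x + - x ≤⟨ +-mono-≤ (- x) x≤y ⟩
      y + - x ∎
    y-x+x≡y : y + - x + x ≡ y
    y-x+x≡y = ≡.trans (+-assoc y (- x) x)
                (≡.trans (≡.cong (y +_) (-‿inverseˡ x)) (+-identityʳ y))

  ∑-mono : {X : Set} (xs : List X) {f g : X → ℝ} → (∀ x → f x ≤ g x) → ∑ xs f ≤ ∑ xs g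
  ∑-mono []       f≤g = ≤-refl
  ∑-mono (x ∷ xs) f≤g = +-mono₂-≤ (f≤g x) (∑-mono xs f≤g)

  module _ {A : Set} where

    ∑-μ-const : (m : Dist R A) (t : ℝ) → ∑[ x ∈ supp m ] (μ m x * t) ≡ t
    ∑-μ-const m = ∑-weighted-const (supp m) (sum-one m)

    LK-mono : {d d′ : A → A → ℝ} → (∀ x y → d x y ≤ d′ x y) →
              ∀ m n → LK R d m n ≤ LK R d′ m n
    LK-mono d≤d′ m n = ∑-mono (supp m) λ x → ∑-mono (supp n) λ y →
      *-monoˡ-≤-nonNeg (*-nonneg (μ-nonneg m x) (μ-nonneg n y)) (d≤d′ x y)

    LK-const : (t : ℝ) (m n : Dist R A) → LK R (λ _ _ → t) m n ≡ t
    LK-const t m n = begin-equality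
      ∑[ x ∈ supp m ] ∑[ y ∈ supp n ] (μ m x * μ n y * t)
        ≡⟨ ∑-cong (supp m) (λ x → ∑-cong (supp n) λ y → *-assoc (μ m x) (μ n y) t) ⟩
      ∑[ x ∈ supp m ] ∑[ y ∈ supp n ] (μ m x * (μ n y * t))
        ≡⟨ ∑-cong (supp m) (λ x → ∑-*ˡ (supp n) (μ m x) (λ y → μ n y * t)) ⟩
      ∑[ x ∈ supp m ] (μ m x * ∑[ y ∈ supp n ] (μ n y * t))
        ≡⟨ ∑-cong (supp m) (λ x → ≡.cong (μ m x *_) (∑-μ-const n t)) ⟩
      ∑[ x ∈ supp m ] (μ m x * t)
        ≡⟨ ∑-μ-const m t ⟩
      t ∎

    LK-sym : {d : A → A → ℝ} → (∀ x y → d x y ≡ d y x) → ∀ m n → LK R d m n ≡ LK R d n m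
    LK-sym {d} d-sym m n = ≡.trans (∑-comm (supp m) (supp n) _)
      (∑-cong (supp n) λ y → ∑-cong (supp m) λ x →
        ≡.cong₂ _*_ (*-comm (μ m x) (μ n y)) (d-sym x y))

    LK-≤-const : {d : A → A → ℝ} {t : ℝ} → (∀ x y → d x y ≤ t) → ∀ m n → LK R d m n ≤ t
    LK-≤-const {d} {t} d≤t m n = begin
      LK R d m n           ≤⟨ LK-mono d≤t m n ⟩
      LK R (λ _ _ → t) m n ≡⟨ LK-const t m n ⟩
      t                    ∎

    LK-≥-const : {d : A → A → ℝ} {t : ℝ} → (∀ x y → t ≤ d x y) → ∀ m n → t ≤ LK R d m n
    LK-≥-const {d} {t} t≤d m n = begin
      t                    ≡⟨ ≡.sym (LK-const t m n) ⟩
      LK R (λ _ _ → t) m n ≤⟨ LK-mono t≤d m n ⟩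
      LK R d m n           ∎

    E₃ : (A → A → A → ℝ) → Dist R A → Dist R A → Dist R A → ℝ
    E₃ g l m n =
      ∑[ x ∈ supp l ] ∑[ y ∈ supp m ] ∑[ z ∈ supp n ] (μ l x * μ m y * μ n z * g x y z)

    E₃-mono : {g h : A → A → A → ℝ} → (∀ x y z → g x y z ≤ h x y z) →
              ∀ l m n → E₃ g l m n ≤ E₃ h l m n
    E₃-mono g≤h l m n = ∑-mono (supp l) λ x → ∑-mono (supp m) λ y → ∑-mono (supp n) λ z →
      *-monoˡ-≤-nonNeg (*-nonneg (*-nonneg (μ-nonneg l x) (μ-nonneg m y)) (μ-nonneg n z))
                       (g≤h x y z)

    E₃-+ : (g h : A → A → A → ℝ) (l m n : Dist R A) →
           E₃ (λ x y z → g x y z + h x y z) l m n ≡ E₃ g l m n + E₃ h l m n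
    E₃-+ g h l m n = ≡.trans (∑-cong (supp l) λ x → ≡.trans (∑-cong (supp m) λ y →
                                ≡.trans (∑-cong (supp n) λ z → distribˡ _ (g x y z) (h x y z))
                                        (∑-+ (supp n) _ _))
                              (∑-+ (supp m) _ _))
                             (∑-+ (supp l) _ _)

    LK-as-E₃₁₂ : (d : A → A → ℝ) (l m n : Dist R A) → LK R d l m ≡ E₃ (λ x y _ → d x y) l m n
    LK-as-E₃₁₂ d l m n = ∑-cong (supp l) λ x → ∑-cong (supp m) λ y → begin-equality
      μ l x * μ m y * d x y
        ≡⟨ ≡.sym (∑-μ-const n _) ⟩
      ∑[ z ∈ supp n ] (μ n z * (μ l x * μ m y * d x y))
        ≡⟨ ∑-cong (supp n) (λ z → ≡.sym (xy∙z≈y∙xz (μ l x * μ m y) (μ n z) (d x y))) ⟩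
      ∑[ z ∈ supp n ] (μ l x * μ m y * μ n z * d x y) ∎

    LK-as-E₃₁₃ : (d : A → A → ℝ) (l m n : Dist R A) → LK R d l n ≡ E₃ (λ x _ z → d x z) l m n
    LK-as-E₃₁₃ d l m n = ∑-cong (supp l) λ x → begin-equality
      ∑[ z ∈ supp n ] (μ l x * μ n z * d x z)
        ≡⟨ ≡.sym (∑-μ-const m _) ⟩
      ∑[ y ∈ supp m ] (μ m y * ∑[ z ∈ supp n ] (μ l x * μ n z * d x z))
        ≡⟨ ∑-cong (supp m) (λ y → ≡.sym (∑-*ˡ (supp n) (μ m y) _)) ⟩
      ∑[ y ∈ supp m ] ∑[ z ∈ supp n ] (μ m y * (μ l x * μ n z * d x z))
        ≡⟨ ∑-cong (supp m) (λ y → ∑-cong (supp n) λ z → reorder (μ l x) (μ m y) (μ n z) (d x z)) ⟩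
      ∑[ y ∈ supp m ] ∑[ z ∈ supp n ] (μ l x * μ m y * μ n z * d x z) ∎
      where
      reorder : ∀ a b c e → b * (a * c * e) ≡ a * b * c * e
      reorder a b c e = ≡.trans (x∙yz≈yx∙z b (a * c) e) (≡.cong (_* e) (xy∙z≈xz∙y a c b))

    LK-as-E₃₂₃ : (d : A → A → ℝ) (l m n : Dist R A) → LK R d m n ≡ E₃ (λ _ y z → d y z) l m n
    LK-as-E₃₂₃ d l m n = begin-equality
      LK R d m n
        ≡⟨ ≡.sym (∑-μ-const l _) ⟩
      ∑[ x ∈ supp l ] (μ l x * LK R d m n)
        ≡⟨ ∑-cong (supp l) (λ x → ≡.sym (∑-*ˡ (supp m) (μ l x) _)) ⟩
      ∑[ x ∈ supp l ] ∑[ y ∈ supp m ] (μ l x * ∑[ z ∈ supp n ] (μ m y * μ n z * d y z))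
        ≡⟨ ∑-cong (supp l) (λ x → ∑-cong (supp m) λ y → ≡.sym (∑-*ˡ (supp n) (μ l x) _)) ⟩
      ∑[ x ∈ supp l ] ∑[ y ∈ supp m ] ∑[ z ∈ supp n ] (μ l x * (μ m y * μ n z * d y z))
        ≡⟨ ∑-cong (supp l) (λ x → ∑-cong (supp m) λ y → ∑-cong (supp n) λ z →
             reassociate (μ l x) (μ m y) (μ n z) (d y z)) ⟩
      E₃ (λ _ y z → d y z) l m n ∎
      where
      reassociate : ∀ a b c e → a * (b * c * e) ≡ a * b * c * e
      reassociate a b c e =
        ≡.trans (≡.sym (*-assoc a (b * c) e)) (≡.cong (_* e) (≡.sym (*-assoc a b c)))

    LK-triangle : {d : A → A → ℝ} → (∀ x y z → d x z ≤ d x y + d y z) →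
                  ∀ l m n → LK R d l n ≤ LK R d l m + LK R d m n
    LK-triangle {d} d-tri l m n = begin
      LK R d l n                                               ≡⟨ LK-as-E₃₁₃ d l m n ⟩
      E₃ (λ x _ z → d x z) l m n                               ≤⟨ E₃-mono d-tri l m n ⟩
      E₃ (λ x y z → d x y + d y z) l m n                       ≡⟨ E₃-+ _ _ l m n ⟩
      E₃ (λ x y _ → d x y) l m n + E₃ (λ _ y z → d y z) l m n
        ≡⟨ ≡.sym (≡.cong₂ _+_ (LK-as-E₃₁₂ d l m n) (LK-as-E₃₂₃ d l m n)) ⟩
      LK R d l m + LK R d m n                                  ∎

proposition5p2 : (R : RealField) (A : Set) (d : A → A → RealField.ℝ R) →
    IsDiffuseMetric R A d → IsDiffuseMetric R (Dist R A) (LK R d)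
proposition5p2 R A d d-metric = record
  { d-nonneg = LK-≥-const d-nonneg
  ; d-le-1   = LK-≤-const d-le-1
  ; d-sym    = LK-sym d-sym
  ; d-tri    = LK-triangle d-tri
  }
  where
  open Kantorovich R
  open IsDiffuseMetric d-metric
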